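{- Let $k\ge2$, let $m\ge1$ be an integer and let $n=\lfloor\log_k((k-1)m+1)\rfloor$. Set $j=\nu_k\!\left(m-\frac{k^n-1}{k-1}\right)+1$ if $m\neq\frac{k^n-1}{k-1}$, and $j=n$ otherwise. Then \[D(m,k)=G(m+1,k)-G(m,k)=\frac{k^{j+1}-(k-1)j-k}{(k-1)^2}.\]
   Context: Fix an integer $k\ge 2$. Let $T_k$ be the infinite rooted $k$-ary tree (every vertex has exactly $k$ children) with one additional self-loop at the root, so every vertex has degree $k+1$. Chip-firing: a vertex with at least $k+1$ chips may fire, sending one chip along each incident edge (a non-root vertex sends one chip to its parent and one to each of its $k$ children; the root sends one chip to each of its $k$ children and one chip to itself along the self-loop). Starting with $N\ge0$ chips at the root and none elsewhere, vertices fire until no vertex can fire; this terminates, and the number of times each vertex fires does not depend on the order of firings. $F(N,k)$ denotes the total number of fires summed over all vertices. For integers $m\ge0$ define $G(m,k)=F(mk,k)$ and $D(m,k)=G(m+1,k)-G(m,k)$. For a positive integer $x$, $\nu_k(x)$ is the largest integer $e\ge0$ with $k^e\mid x$ (number of trailing zeros of $x$ in base $k$). -}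

module Defs where

open import Data.Nat using (ℕ; zero; suc; _+_; _*_; _∸_; _^_; _≤_; _<_)
open import Data.Nat.DivMod using (_/_)
open import Data.Nat.Divisibility using (_∣_)
open import Data.Fin using (Fin) renaming (_≟_ to _≟F_)
open import Data.List using (List; []; _∷_)
open import Data.List.Properties using (≡-dec)
open import Data.Product using (Σ; _×_; ∃)
open import Data.Sum using (_⊎_)
open import Relation.Nullary using (¬_; yes; no)
open import Relation.Binary.PropositionalEquality using (_≡_; _≢_)

-- Vertices of the infinite rooted k-ary tree: words over Fin k.
-- The root is [], the children of v are (i ∷ v) for i : Fin k,
-- so the parent of (i ∷ v) is v.
Vertex : ℕ → Set
Vertex k = List (Fin k)

_≟V_ : ∀ {k} → (v w : Vertex k) → Relation.Nullary.Dec (v ≡ w)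
_≟V_ = ≡-dec _≟F_

childEdge : ∀ {k} → Vertex k → Vertex k → ℕ
childEdge v [] = 0
childEdge v (i ∷ w) with v ≟V w
... | yes _ = 1
... | no  _ = 0

loopEdge : ∀ {k} → Vertex k → Vertex k → ℕ
loopEdge [] [] = 1
loopEdge _  _  = 0

adj : ∀ {k} → Vertex k → Vertex k → ℕ
adj v w = childEdge v w + childEdge w v + loopEdge v w

Config : ℕ → Set
Config k = Vertex k → ℕ

-- firing v: v loses k+1 chips (one along each incident edge),
-- every w receives one chip per edge from v to w
-- (the root receives one back along its self-loop).
fire : ∀ k → Vertex k → Config k → Config k
fire k v c w with v ≟V w
... | yes _ = (c w + adj v w) ∸ suc k
... | no  _ = c w + adj v w

data Run (k : ℕ) : Config k → Config k → ℕ → Set where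
  done : ∀ {c} → Run k c c 0
  step : ∀ {c c' n} (v : Vertex k) → suc k ≤ c v →
         Run k (fire k v c) c' n → Run k c c' (suc n)

Stable : ∀ k → Config k → Set
Stable k c = ∀ v → c v < suc k

initial : ∀ k → ℕ → Config k
initial k N [] = N
initial k N (_ ∷ _) = 0

-- IsF N k f : f is the total number of fires of some legal firing
-- sequence from the initial configuration that ends in a stable
-- configuration.  (By the context, f = F(N,k) is independent of choices.)
IsF : ℕ → ℕ → ℕ → Set
IsF N k f = Σ (Config k) λ c' → Run k (initial k N) c' f × Stable k c'

IsG : ℕ → ℕ → ℕ → Set
IsG m k g = IsF (m * k) k g

-- total division (only used with nonzero divisors, namely k-1 and (k-1)^2 for k ≥ 2)
_div_ : ℕ → ℕ → ℕ
a div zero = 0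
a div suc d = a / suc d

rep : ℕ → ℕ → ℕ
rep k n = (k ^ n ∸ 1) div (k ∸ 1)

IsNu : ℕ → ℕ → ℕ → Set
IsNu k x e = (k ^ e ∣ x) × ¬ (k ^ suc e ∣ x)

IsFloorLog : ℕ → ℕ → ℕ → Set
IsFloorLog k a n = (k ^ n ≤ a) × (a < k ^ suc n)

IsJ : ℕ → ℕ → ℕ → ℕ → Set
IsJ k m n j =
  (m ≡ rep k n × j ≡ n) ⊎
  (m ≢ rep k n × ∃ λ e → IsNu k (m ∸ rep k n) e × j ≡ suc e)

formula : ℕ → ℕ → ℕ
formula k j = (k ^ suc j ∸ (k ∸ 1) * j ∸ k) div ((k ∸ 1) ^ 2)

{-# OPTIONS --safe #-}
module Submission where

-- Write i in bijective base k (digits 1, …, k, least significant first).  Once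
-- (i + 1) k chips at the root have stabilised, the root holds k chips and a
-- vertex at depth d ≥ 1 holds the d-th digit of i (none beyond its length).
-- Adding k chips to the root increments the numeral: if its j − 1 lowest digits
-- equal k, every vertex at depth d < j fires exactly j − d times, so
-- D(i + 1, k) = Σ_{d<j} (j − d) k^d, which is the closed formula.
--
-- These firing counts are forced.  By the least action principle a legal run
-- fires no vertex more often than any odometer leading to a stable
-- configuration.  Conversely, if W is such an odometer for the avalanche, the
-- minimum of W over depth d drops by at least one from each depth to the next
-- as long as the vertices there are full, so W ≥ j − d at depth d.  Finally, the
-- number j − 1 of lowest digits of m − 1 equal to k is ν_k(m − (k^n − 1)/(k − 1)),
-- unless all digits are k, in which case m = (k^n − 1)/(k − 1) and j = n.

open import Defs
open import Data.Nat
  using (ℕ; zero; suc; _+_; _*_; _∸_; _^_; _≤_; _<_; _⊔_; _≟_; _≤?_; z≤n; s≤s; NonZero; >-nonZero; >-nonZero⁻¹)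
open import Data.Nat.Properties
open import Data.Nat.DivMod using (m*n/n≡m)
open import Data.Nat.Divisibility using (_∣_; divides; ∣-trans; ∣m+n∣m⇒∣n; ∣⇒≤; m∣m*n; *-cancelˡ-∣)
open import Data.Nat.Tactic.RingSolver using (solve-∀)
open import Data.Fin using (Fin; zero; suc; punchIn)
open import Data.Fin.Properties using (punchInᵢ≢i)
open import Data.List using (List; []; _∷_; length; allFin)
open import Data.List.Properties using (∷-injectiveˡ; ∷-injectiveʳ)
open import Data.List.Relation.Unary.All using (All; []; _∷_) renaming (lookup to lookupAll)
open import Data.List.Membership.Propositional.Properties using (∈-allFin)
import Data.List.Extrema ≤-totalOrder as Extrema
open import Data.Bool using (if_then_else_)
open import Data.Product using (∃; _×_; _,_; proj₁; proj₂)
open import Data.Sum using (_⊎_; inj₁; inj₂)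
open import Function using (_∘_)
open import Relation.Nullary using (¬_; yes; no; does; contradiction)
open import Relation.Nullary.Decidable using (dec-true; dec-false; does-⇔)
open import Function.Bundles using (mk⇔)
open import Relation.Binary.PropositionalEquality
open import Algebra.Properties.Semiring.Sum +-*-semiring
  using (sum; sum-cong-≗; ∑-distrib-+; sum-remove; sum-replicate-zero)
open import Algebra.Properties.CommutativeSemigroup +-commutativeSemigroup
  using (interchange; xy∙z≈xz∙y)

sum-mono : ∀ {n} {f g : Fin n → ℕ} → (∀ i → f i ≤ g i) → sum f ≤ sum g
sum-mono {zero}  _   = z≤n
sum-mono {suc n} f≤g = +-mono-≤ (f≤g zero) (sum-mono (f≤g ∘ suc))

sum-const : ∀ n c → sum {n} (λ _ → c) ≡ n * c
sum-const zero    c = refl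
sum-const (suc n) c = cong (c +_) (sum-const n c)

sum-zero : ∀ {n} {f : Fin n → ℕ} → (∀ i → f i ≡ 0) → sum f ≡ 0
sum-zero {n} f≗0 = trans (sum-cong-≗ {y = λ _ → 0} f≗0) (sum-replicate-zero n)

sum-single : ∀ {n} (f : Fin n → ℕ) x → (∀ i → x ≢ i → f i ≡ 0) → sum f ≡ f x
sum-single {suc n} f x vanish = begin
  sum f                             ≡⟨ sum-remove f ⟩
  f x + sum (f ∘ punchIn x)         ≡⟨ cong (f x +_) (sum-zero (λ j → vanish _ (punchInᵢ≢i x j ∘ sym))) ⟩
  f x + 0                           ≡⟨ +-identityʳ (f x) ⟩
  f x                               ∎
  where open ≡-Reasoning

Odometer : ℕ → Set
Odometer k = Vertex k → ℕ

module _ {k : ℕ} where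

  infixl 6 _⊕_
  infix  4 _≤̇_

  _⊕_ : Odometer k → Odometer k → Odometer k
  (U ⊕ V) v = U v + V v

  0̇ : Odometer k
  0̇ _ = 0

  _≤̇_ : Odometer k → Odometer k → Set
  U ≤̇ V = ∀ v → U v ≤ V v

  -- Through its self-loop the root is its own parent.
  up : Vertex k → Vertex k
  up []      = []
  up (_ ∷ v) = v

  δ : Vertex k → Odometer k
  δ v w = if does (v ≟V w) then 1 else 0

  received : Odometer k → Vertex k → ℕ
  received U w = U (up w) + sum (λ i → U (i ∷ w))

  δ-refl : ∀ v → δ v v ≡ 1
  δ-refl v rewrite dec-true (v ≟V v) refl = refl

  δ-≢ : ∀ {v w} → v ≢ w → δ v w ≡ 0
  δ-≢ {v} {w} v≢w rewrite dec-false (v ≟V w) v≢w = refl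

  δ-resp : ∀ {v w v′ w′} → (v ≡ w → v′ ≡ w′) → (v′ ≡ w′ → v ≡ w) → δ v w ≡ δ v′ w′
  δ-resp {v} {w} {v′} {w′} to from =
    cong (λ b → if b then 1 else 0) (does-⇔ (mk⇔ to from) (v ≟V w) (v′ ≟V w′))

  δ-sym : ∀ v w → δ v w ≡ δ w v
  δ-sym v w = δ-resp {v} {w} sym sym

  δ-∷ : ∀ x v w → δ (x ∷ v) (x ∷ w) ≡ δ v w
  δ-∷ x v w = δ-resp {x ∷ v} {x ∷ w} ∷-injectiveʳ (cong (x ∷_))

  δ-∷-≢ : ∀ {x i} v w → x ≢ i → δ (x ∷ v) (i ∷ w) ≡ 0
  δ-∷-≢ v w x≢i = δ-≢ {_ ∷ v} {_ ∷ w} (x≢i ∘ ∷-injectiveˡ)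

  childEdge-∷ : ∀ v i w → childEdge v (i ∷ w) ≡ δ v w
  childEdge-∷ v i w with v ≟V w
  ... | yes _ = refl
  ... | no _  = refl

  δ-up : ∀ v w → δ v (up w) ≡ childEdge v w + loopEdge v w
  δ-up []      []      = refl
  δ-up (_ ∷ _) []      = refl
  δ-up []      (i ∷ w) = sym (trans (+-identityʳ _) (childEdge-∷ [] i w))
  δ-up (x ∷ v) (i ∷ w) = sym (trans (+-identityʳ _) (childEdge-∷ (x ∷ v) i w))

  sum-δ-children : ∀ v w → sum (λ i → δ v (i ∷ w)) ≡ childEdge w v
  sum-δ-children []      w = sum-replicate-zero k
  sum-δ-children (x ∷ v) w = begin
    sum (λ i → δ (x ∷ v) (i ∷ w)) ≡⟨ sum-single _ x (λ i → δ-∷-≢ v w) ⟩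
    δ (x ∷ v) (x ∷ w)             ≡⟨ δ-∷ x v w ⟩
    δ v w                         ≡⟨ δ-sym v w ⟩
    δ w v                         ≡⟨ childEdge-∷ w x v ⟨
    childEdge w (x ∷ v)           ∎
    where open ≡-Reasoning

  received-δ : ∀ v w → received (δ v) w ≡ adj v w
  received-δ v w = begin
    δ v (up w) + sum (λ i → δ v (i ∷ w))          ≡⟨ cong₂ _+_ (δ-up v w) (sum-δ-children v w) ⟩
    childEdge v w + loopEdge v w + childEdge w v  ≡⟨ xy∙z≈xz∙y (childEdge v w) _ _ ⟩
    adj v w                                       ∎
    where open ≡-Reasoning

  received-⊕ : ∀ U V w → received (U ⊕ V) w ≡ received U w + received V w
  received-⊕ U V w = begin
    U (up w) + V (up w) + sum (λ i → U (i ∷ w) + V (i ∷ w))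
      ≡⟨ cong (U (up w) + V (up w) +_) (∑-distrib-+ (λ i → U (i ∷ w)) (λ i → V (i ∷ w))) ⟩
    U (up w) + V (up w) + (sum (λ i → U (i ∷ w)) + sum (λ i → V (i ∷ w)))
      ≡⟨ interchange (U (up w)) _ _ _ ⟩
    received U w + received V w
      ∎
    where open ≡-Reasoning

  received-0̇ : ∀ w → received 0̇ w ≡ 0
  received-0̇ w = sum-replicate-zero k

  received-cong : ∀ {U V} → U ≗ V → ∀ w → received U w ≡ received V w
  received-cong U≗V w = cong₂ _+_ (U≗V (up w)) (sum-cong-≗ (λ i → U≗V (i ∷ w)))

  received-mono : ∀ {U V} → U ≤̇ V → ∀ w → received U w ≤ received V w
  received-mono U≤V w = +-mono-≤ (U≤V (up w)) (sum-mono (λ i → U≤V (i ∷ w)))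

-- Firing every vertex v exactly U v times turns c into c′; the individual
-- firings need not be legal, and the relation is stated without subtraction.
record _─[_]→_ {k} (c : Config k) (U : Odometer k) (c′ : Config k) : Set where
  constructor balanced
  field balance : ∀ w → c′ w + suc k * U w ≡ c w + received U w

open _─[_]→_

Stabilizing : ∀ {k} → Config k → Odometer k → Set
Stabilizing {k} c U = ∀ w → c w + received U w ≤ k + suc k * U w

runOdometer : ∀ {k c c′ n} → Run k c c′ n → Odometer k
runOdometer done         = 0̇
runOdometer (step v _ r) = δ v ⊕ runOdometer r

module _ {k : ℕ} where

  private
    variable
      a c c′ c″ c₁ : Config k
      U V p : Odometer k
      v : Vertex k
      n : ℕ

  ─→-refl : c ≗ c′ → c ─[ 0̇ ]→ c′
  ─→-refl {c} {c′} c≗c′ = balanced λ w → begin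
    c′ w + suc k * 0    ≡⟨ cong₂ _+_ (sym (c≗c′ w)) (*-zeroʳ (suc k)) ⟩
    c w + 0             ≡⟨ cong (c w +_) (received-0̇ w) ⟨
    c w + received 0̇ w  ∎
    where open ≡-Reasoning

  ─→-trans : c ─[ U ]→ c′ → c′ ─[ V ]→ c″ → c ─[ U ⊕ V ]→ c″
  ─→-trans {c} {U} {c′} {V} {c″} c→c′ c′→c″ = balanced λ w → begin
    c″ w + suc k * (U w + V w)          ≡⟨ split (c″ w) (suc k) (U w) (V w) ⟩
    c″ w + suc k * V w + suc k * U w    ≡⟨ cong (_+ suc k * U w) (balance c′→c″ w) ⟩
    c′ w + received V w + suc k * U w   ≡⟨ xy∙z≈xz∙y (c′ w) _ _ ⟩
    c′ w + suc k * U w + received V w   ≡⟨ cong (_+ received V w) (balance c→c′ w) ⟩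
    c w + received U w + received V w   ≡⟨ +-assoc (c w) _ _ ⟩
    c w + (received U w + received V w) ≡⟨ cong (c w +_) (received-⊕ U V w) ⟨
    c w + received (U ⊕ V) w            ∎
    where
    open ≡-Reasoning
    split : ∀ x s u v → x + s * (u + v) ≡ x + s * v + s * u
    split = solve-∀

  ─→-addˡ : c ─[ U ]→ c′ → (a ⊕ c) ─[ U ]→ (a ⊕ c′)
  ─→-addˡ {c} {U} {c′} {a} c→c′ = balanced λ w → begin
    a w + c′ w + suc k * U w   ≡⟨ +-assoc (a w) _ _ ⟩
    a w + (c′ w + suc k * U w) ≡⟨ cong (a w +_) (balance c→c′ w) ⟩
    a w + (c w + received U w) ≡⟨ +-assoc (a w) _ _ ⟨
    a w + c w + received U w   ∎
    where open ≡-Reasoning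

  fire-─→ : suc k ≤ c v → c ─[ δ v ]→ fire k v c
  fire-─→ {c} {v} legal = balanced λ w → trans (fire-adj w) (cong (c w +_) (sym (received-δ v w)))
    where
    fire-adj : ∀ w → fire k v c w + suc k * δ v w ≡ c w + adj v w
    fire-adj w with v ≟V w
    ... | yes refl = trans (cong₂ _+_ refl (*-identityʳ (suc k)))
                           (m∸n+n≡m (≤-trans legal (m≤m+n (c v) (adj v v))))
    ... | no _     = trans (cong₂ _+_ refl (*-zeroʳ (suc k))) (+-identityʳ (c w + adj v w))

  run-─→ : (r : Run k c c′ n) → c ─[ runOdometer r ]→ c′
  run-─→ done             = ─→-refl (λ _ → refl)
  run-─→ (step v legal r) = ─→-trans (fire-─→ legal) (run-─→ r)

  ─→-stabilizing : c ─[ U ]→ c′ → Stable k c′ → Stabilizing c U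
  ─→-stabilizing {c} {U} {c′} c→c′ stable w = begin
    c w + received U w ≡⟨ balance c→c′ w ⟨
    c′ w + suc k * U w ≤⟨ +-monoˡ-≤ _ (≤-pred (stable w)) ⟩
    k + suc k * U w    ∎
    where open ≤-Reasoning

  stabilizing-≗ : c ≗ c′ → Stabilizing c U → Stabilizing c′ U
  stabilizing-≗ {c} {c′} {U} c≗c′ stab w = subst (λ x → x + received U w ≤ _) (c≗c′ w) (stab w)

  stabilizing-addˡ : Stabilizing (a ⊕ c) U → Stabilizing c U
  stabilizing-addˡ {a} {c} stab w = ≤-trans (+-monoˡ-≤ _ (m≤n+m (c w) (a w))) (stab w)

  stabilizing-residual : c ─[ U ]→ c′ → U ≤̇ V → Stabilizing c V → Stabilizing c′ (λ w → V w ∸ U w)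
  stabilizing-residual {c} {U} {c′} {V} c→c′ U≤V stab w = +-cancelʳ-≤ (suc k * U w) _ _ (begin
      c′ w + received R w + suc k * U w   ≡⟨ xy∙z≈xz∙y (c′ w) _ _ ⟩
      c′ w + suc k * U w + received R w   ≡⟨ cong (_+ received R w) (balance c→c′ w) ⟩
      c w + received U w + received R w   ≡⟨ +-assoc (c w) _ _ ⟩
      c w + (received U w + received R w) ≡⟨ cong (c w +_) (received-⊕ U R w) ⟨
      c w + received (U ⊕ R) w            ≡⟨ cong (c w +_) (received-cong V≗U⊕R w) ⟨
      c w + received V w                  ≤⟨ stab w ⟩
      k + suc k * V w                     ≡⟨ cong (λ x → k + suc k * x) (V≗U⊕R w) ⟩
      k + suc k * (U w + R w)             ≡⟨ split k (suc k) (U w) (R w) ⟩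
      k + suc k * R w + suc k * U w       ∎)
    where
    open ≤-Reasoning
    R : Odometer k
    R w = V w ∸ U w
    V≗U⊕R : V ≗ U ⊕ R
    V≗U⊕R w = sym (m+[n∸m]≡n (U≤V w))
    split : ∀ x s u r → x + s * (u + r) ≡ x + s * r + s * u
    split = solve-∀

  private
    ⊕δ-≤̇ : p ≤̇ U → p v < U v → p ⊕ δ v ≤̇ U
    ⊕δ-≤̇ {p} {U} {v} p≤U pv<Uv w with v ≟V w
    ... | yes refl = subst (_≤ U v) (+-comm 1 (p v)) pv<Uv
    ... | no _     = subst (_≤ U w) (sym (+-identityʳ (p w))) (p≤U w)

    legal-below : Stabilizing c U → c ─[ p ]→ c₁ → p ≤̇ U → suc k ≤ c₁ v → p v < U v
    legal-below {c} {U} {p} {c₁} {v} stab c→c₁ p≤U legal = ≰⇒> λ Uv≤pv →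
      <⇒≱ legal (+-cancelʳ-≤ (suc k * p v) (c₁ v) k (begin
        c₁ v + suc k * p v ≡⟨ balance c→c₁ v ⟩
        c v + received p v ≤⟨ +-monoʳ-≤ (c v) (received-mono p≤U v) ⟩
        c v + received U v ≤⟨ stab v ⟩
        k + suc k * U v    ≤⟨ +-monoʳ-≤ k (*-monoʳ-≤ (suc k) Uv≤pv) ⟩
        k + suc k * p v    ∎))
      where open ≤-Reasoning

  least-action : Stabilizing c U → (r : Run k c c′ n) → runOdometer r ≤̇ U
  least-action {c} {U} stab = continue (─→-refl (λ _ → refl)) (λ _ → z≤n)
    where
    continue : ∀ {p c₁ c′ n} → c ─[ p ]→ c₁ → p ≤̇ U → (r : Run k c₁ c′ n) → p ⊕ runOdometer r ≤̇ U
    continue {p} _ p≤U done w = subst (_≤ U w) (sym (+-identityʳ (p w))) (p≤U w)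
    continue {p} c→c₁ p≤U (step v legal r) w =
      subst (_≤ U w) (+-assoc (p w) (δ v w) (runOdometer r w))
        (continue (─→-trans c→c₁ (fire-─→ legal)) (⊕δ-≤̇ p≤U (legal-below stab c→c₁ p≤U legal)) r w)

  ballSum : ℕ → Odometer k → ℕ
  ballSum zero    U = U []
  ballSum (suc D) U = U [] + sum (λ i → ballSum D (U ∘ (i ∷_)))

  ballSum-cong : ∀ D → U ≗ V → ballSum D U ≡ ballSum D V
  ballSum-cong zero    U≗V = U≗V []
  ballSum-cong (suc D) U≗V = cong₂ _+_ (U≗V []) (sum-cong-≗ (λ i → ballSum-cong D (U≗V ∘ (i ∷_))))

  ballSum-⊕ : ∀ D U V → ballSum D (U ⊕ V) ≡ ballSum D U + ballSum D V
  ballSum-⊕ zero    U V = refl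
  ballSum-⊕ (suc D) U V = begin
    U [] + V [] + sum (λ i → ballSum D ((U ⊕ V) ∘ (i ∷_)))
      ≡⟨ cong (U [] + V [] +_) (sum-cong-≗ (λ i → ballSum-⊕ D (U ∘ (i ∷_)) (V ∘ (i ∷_)))) ⟩
    U [] + V [] + sum (λ i → ballSum D (U ∘ (i ∷_)) + ballSum D (V ∘ (i ∷_)))
      ≡⟨ cong (U [] + V [] +_) (∑-distrib-+ (λ i → ballSum D (U ∘ (i ∷_))) _) ⟩
    U [] + V [] + (sum (λ i → ballSum D (U ∘ (i ∷_))) + sum (λ i → ballSum D (V ∘ (i ∷_))))
      ≡⟨ interchange (U []) _ _ _ ⟩
    ballSum (suc D) U + ballSum (suc D) V
      ∎
    where open ≡-Reasoning

  ballSum-0̇ : ∀ D → ballSum D 0̇ ≡ 0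
  ballSum-0̇ zero    = refl
  ballSum-0̇ (suc D) = sum-zero {k} (λ _ → ballSum-0̇ D)

  ballSum-δ : ∀ D v → length v ≤ D → ballSum D (δ v) ≡ 1
  ballSum-δ zero    []      _ = δ-refl {k} []
  ballSum-δ (suc D) []      _ = cong₂ _+_ (δ-refl {k} []) (ballSum-0̇ (suc D))
  ballSum-δ (suc D) (x ∷ v) (s≤s |v|≤D) = begin
    sum (λ i → ballSum D (δ (x ∷ v) ∘ (i ∷_))) ≡⟨ sum-single _ x elsewhere ⟩
    ballSum D (δ (x ∷ v) ∘ (x ∷_))             ≡⟨ ballSum-cong D (δ-∷ x v) ⟩
    ballSum D (δ v)                            ≡⟨ ballSum-δ D v |v|≤D ⟩
    1                                          ∎
    where
    open ≡-Reasoning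
    elsewhere : ∀ i → x ≢ i → ballSum D (δ (x ∷ v) ∘ (i ∷_)) ≡ 0
    elsewhere i x≢i = trans (ballSum-cong D (λ w → δ-∷-≢ v w x≢i)) (ballSum-0̇ D)

  run-length : (r : Run k c c′ n) → ∃ λ D₀ → ∀ {D} → D₀ ≤ D → n ≡ ballSum D (runOdometer r)
  run-length done = 0 , λ {D} _ → sym (ballSum-0̇ D)
  run-length (step v legal r) with run-length r
  ... | D₀ , length≡ = D₀ ⊔ length v , λ {D} D₀⊔|v|≤D → begin
    suc _                                         ≡⟨ cong₂ _+_ (sym (ballSum-δ D v (m⊔n≤o⇒n≤o D₀ _ D₀⊔|v|≤D)))
                                                               (length≡ (m⊔n≤o⇒m≤o D₀ _ D₀⊔|v|≤D)) ⟩
    ballSum D (δ v) + ballSum D (runOdometer r)   ≡⟨ ballSum-⊕ D (δ v) (runOdometer r) ⟨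
    ballSum D (runOdometer (step v legal r))      ∎
    where open ≡-Reasoning

minFin : ∀ {n} .{{_ : NonZero n}} (f : Fin n → ℕ) → ∃ λ i → ∀ j → f i ≤ f j
minFin {suc n} f = argmin f zero all , λ j → lookupAll (f[argmin]≤f[xs] {f = f} zero all) (∈-allFin j)
  where
  open Extrema using (argmin; f[argmin]≤f[xs])
  all = allFin (suc n)

module _ {k : ℕ} where

  IsLevelMin : Odometer k → ℕ → Vertex k → Set
  IsLevelMin W d x = length x ≡ d × (∀ y → length y ≡ d → W x ≤ W y)

  levelMin : .{{_ : NonZero k}} → ∀ W d → ∃ (IsLevelMin W d)
  levelMin W zero    = [] , refl , λ { [] _ → ≤-refl }
  levelMin W (suc d) = i ∷ x i , cong suc (|x| i) , minimal
    where
    below : ∀ i → ∃ (IsLevelMin (W ∘ (i ∷_)) d)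
    below i = levelMin (W ∘ (i ∷_)) d
    x = λ i → proj₁ (below i)
    |x| = λ i → proj₁ (proj₂ (below i))
    best = minFin (λ i → W (i ∷ x i))
    i = proj₁ best
    minimal : ∀ y → length y ≡ suc d → W (i ∷ x i) ≤ W y
    minimal (j ∷ y) |y|≡ = ≤-trans (proj₂ best j) (proj₂ (proj₂ (below j)) y (suc-injective |y|≡))

  descent-arith : ∀ {a b c p} → k + suc a ≤ c + p → c + (p + k * b) ≤ k + suc k * a → b < a
  descent-arith {a} {b} {c} {p} full balance = *-cancelˡ-< k b a (+-cancelˡ-≤ (k + a) _ _ (begin
    k + a + suc (k * b) ≡⟨ shift k a (k * b) ⟩
    k + suc a + k * b   ≤⟨ +-monoˡ-≤ (k * b) full ⟩
    c + p + k * b       ≡⟨ +-assoc c p (k * b) ⟩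
    c + (p + k * b)     ≤⟨ balance ⟩
    k + suc k * a       ≡⟨ +-assoc k a (k * a) ⟨
    k + a + k * a       ∎))
    where
    open ≤-Reasoning
    shift : ∀ m a n → m + a + suc n ≡ m + suc a + n
    shift = solve-∀

  -- The root receives from itself through its loop, so it needs k extra chips
  -- for its level minimum to drop.
  module Descent .{{_ : NonZero k}} (c : Config k) (W : Odometer k) (stab : Stabilizing c W) (j : ℕ)
                 (root-full : k + k ≤ c []) (full : ∀ x v → suc (length v) < j → k ≤ c (x ∷ v)) where

    descent-step : ∀ {d w x} → IsLevelMin W (suc d) x → length w ≡ d →
                   k + suc (W w) ≤ c w + W (up w) → W x < W w
    descent-step {d} {w} {x} (_ , minimal) refl full-w = descent-arith {c = c w} {p = W (up w)} full-w (begin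
      c w + (W (up w) + k * W x)              ≤⟨ +-monoʳ-≤ (c w) (+-monoʳ-≤ (W (up w)) children) ⟩
      c w + received W w                      ≤⟨ stab w ⟩
      k + suc k * W w                         ∎)
      where
      open ≤-Reasoning
      children : k * W x ≤ sum (λ i → W (i ∷ w))
      children = subst (_≤ _) (sum-const k (W x)) (sum-mono (λ i → minimal (i ∷ w) refl))

    descent : ∀ d {x w} → d < j → IsLevelMin W (suc d) x → length w ≡ d → W x < W w
    descent zero    {w = []} _ x-min _ = descent-step x-min refl (begin
      k + suc (W [])  ≡⟨ +-suc k (W []) ⟩
      suc k + W []    ≤⟨ +-monoˡ-≤ (W []) (+-monoˡ-≤ k (>-nonZero⁻¹ k)) ⟩
      k + k + W []    ≤⟨ +-monoˡ-≤ (W []) root-full ⟩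
      c [] + W []     ∎)
      where open ≤-Reasoning
    descent (suc d) {x} {w} d<j x-min |w|≡ with levelMin W (suc d)
    ... | z@(z₀ ∷ z′) , |z|≡ , z-min =
      <-≤-trans (descent-step x-min |z|≡ (+-mono-≤ (full z₀ z′ z-depth) z<up)) (z-min w |w|≡)
      where
      z-depth : suc (length z′) < j
      z-depth = subst (_< j) (sym |z|≡) d<j
      z<up : W z < W z′
      z<up = descent d (<-trans (n<1+n d) d<j) (|z|≡ , z-min) (suc-injective |z|≡)

    lower-bound : ∀ t {v} → length v + t ≤ j → t ≤ W v
    lower-bound zero    _ = z≤n
    lower-bound (suc t) {v} |v|+1+t≤j with levelMin W (suc (length v))
    ... | x , |x|≡ , x-min =
      ≤-trans (s≤s (lower-bound t |x|+t≤j)) (descent (length v) |v|<j (|x|≡ , x-min) refl)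
      where
      |v|+t<j : length v + t < j
      |v|+t<j = subst (_≤ j) (+-suc (length v) t) |v|+1+t≤j
      |x|+t≤j : length x + t ≤ j
      |x|+t≤j = subst (λ l → l + t ≤ j) (sym |x|≡) |v|+t<j
      |v|<j : length v < j
      |v|<j = ≤-<-trans (m≤m+n (length v) t) |v|+t<j

    bound : ∀ v → j ∸ length v ≤ W v
    bound v with length v ≤? j
    ... | yes |v|≤j = lower-bound (j ∸ length v) (≤-reflexive (m+[n∸m]≡n |v|≤j))
    ... | no  |v|≰j = subst (_≤ W v) (sym (m≤n⇒m∸n≡0 (<⇒≤ (≰⇒> |v|≰j)))) z≤n

module _ (k : ℕ) where

  levelSum : ℕ → (ℕ → ℕ) → ℕ
  levelSum zero    f = f 0
  levelSum (suc D) f = f 0 + k * levelSum D (f ∘ suc)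

  ballSum-length : ∀ D f → ballSum {k} D (f ∘ length) ≡ levelSum D f
  ballSum-length zero    f = refl
  ballSum-length (suc D) f =
    cong (f 0 +_) (trans (sum-cong-≗ {k} (λ _ → ballSum-length D (f ∘ suc))) (sum-const k _))

  levelSum-0 : ∀ D → levelSum D (λ _ → 0) ≡ 0
  levelSum-0 zero    = refl
  levelSum-0 (suc D) = trans (cong (k *_) (levelSum-0 D)) (*-zeroʳ k)

  avalancheFires : ℕ → ℕ
  avalancheFires zero    = 0
  avalancheFires (suc j) = suc j + k * avalancheFires j

  levelSum-∸ : ∀ j D → j ≤ D → levelSum D (j ∸_) ≡ avalancheFires j
  levelSum-∸ zero    zero    _         = refl
  levelSum-∸ zero    (suc D) _         = levelSum-0 (suc D)
  levelSum-∸ (suc j) (suc D) (s≤s j≤D) = cong (λ s → suc j + k * s) (levelSum-∸ j D j≤D)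

initial-+ : ∀ {k} M N → initial k (M + N) ≗ initial k M ⊕ initial k N
initial-+ M N []      = refl
initial-+ M N (_ ∷ _) = refl

module _ (k : ℕ) where

  increment : List ℕ → List ℕ
  increment []       = 1 ∷ []
  increment (x ∷ xs) with x ≟ k
  ... | yes _ = 1 ∷ increment xs
  ... | no _  = suc x ∷ xs

  numeral : ℕ → List ℕ
  numeral zero    = []
  numeral (suc i) = increment (numeral i)

  kRun : List ℕ → ℕ
  kRun []       = 0
  kRun (x ∷ xs) with x ≟ k
  ... | yes _ = suc (kRun xs)
  ... | no _  = 0

  digit : List ℕ → ℕ → ℕ
  digit []       _       = 0
  digit (x ∷ _)  zero    = x
  digit (_ ∷ xs) (suc e) = digit xs e

  stableConfig : List ℕ → Config k
  stableConfig _  []      = k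
  stableConfig xs (_ ∷ v) = digit xs (length v)

  avalanche : List ℕ → Odometer k
  avalanche xs v = suc (kRun xs) ∸ length v

  odometer : ℕ → Odometer k
  odometer zero    = 0̇
  odometer (suc i) = odometer i ⊕ avalanche (numeral i)

  avalanche-level : ∀ xs e → digit (increment xs) e + suc k * (kRun xs ∸ e)
                            ≡ digit xs e + ((suc (kRun xs) ∸ e) + k * (kRun xs ∸ suc e))
  avalanche-level []       zero    = refl
  avalanche-level []       (suc e) = cong (λ x → x + k * 0) (sym (0∸n≡0 e))
  avalanche-level (x ∷ xs) e with x ≟ k
  avalanche-level (x ∷ xs) zero    | yes refl = carry k (kRun xs)
    where
    carry : ∀ m t → 1 + suc m * suc t ≡ m + (suc (suc t) + m * t)
    carry = solve-∀
  avalanche-level (x ∷ xs) (suc e) | yes refl = avalanche-level xs e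
  avalanche-level (x ∷ xs) zero    | no _     = sym (+-suc x (k * 0))
  avalanche-level (x ∷ xs) (suc e) | no _     = cong (λ y → digit xs e + (y + k * 0)) (sym (0∸n≡0 e))

  avalanche-─→ : ∀ xs → (initial k k ⊕ stableConfig xs) ─[ avalanche xs ]→ stableConfig (increment xs)
  avalanche-─→ xs = balanced λ
    { []      → trans (root k (kRun xs))
                      (cong (λ s → k + k + (suc (kRun xs) + s)) (sym (sum-const k (kRun xs))))
    ; (x ∷ v) → trans (avalanche-level xs (length v))
                      (cong (λ s → digit xs (length v) + ((suc (kRun xs) ∸ length v) + s))
                            (sym (sum-const k (kRun xs ∸ suc (length v)))))
    }
    where
    root : ∀ m t → m + suc m * suc t ≡ m + m + (suc t + m * t)
    root = solve-∀

  odometer-─→ : ∀ i → initial k (suc i * k) ─[ odometer i ]→ stableConfig (numeral i)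
  odometer-─→ zero    = ─→-refl λ { [] → +-identityʳ k ; (_ ∷ _) → refl }
  odometer-─→ (suc i) =
    ─→-trans (─→-refl (initial-+ k (suc i * k)))
      (─→-trans (─→-addˡ (odometer-─→ i)) (avalanche-─→ (numeral i)))

  Digits : List ℕ → Set
  Digits = All (λ x → 1 ≤ x × x ≤ k)

  value : List ℕ → ℕ
  value []       = 0
  value (x ∷ xs) = x + k * value xs

  value-increment : ∀ xs → value (increment xs) ≡ suc (value xs)
  value-increment []       = cong suc (*-zeroʳ k)
  value-increment (x ∷ xs) with x ≟ k
  ... | yes refl = trans (cong (λ v → 1 + k * v) (value-increment xs)) (cong suc (*-suc k (value xs)))
  ... | no _     = refl

  value-numeral : ∀ i → value (numeral i) ≡ i
  value-numeral zero    = refl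
  value-numeral (suc i) = trans (value-increment (numeral i)) (cong suc (value-numeral i))

  repunit : ℕ → ℕ
  repunit zero    = 0
  repunit (suc D) = 1 + k * repunit D

module _ (k : ℕ) .{{_ : NonZero k}} where

  increment-Digits : ∀ {xs} → Digits k xs → Digits k (increment k xs)
  increment-Digits {[]}     []          = (≤-refl , >-nonZero⁻¹ k) ∷ []
  increment-Digits {x ∷ xs} (x∈ ∷ xs∈) with x ≟ k
  ... | yes _   = (≤-refl , >-nonZero⁻¹ k) ∷ increment-Digits xs∈
  ... | no  x≢k = (s≤s z≤n , ≤∧≢⇒< (proj₂ x∈) x≢k) ∷ xs∈

  numeral-Digits : ∀ i → Digits k (numeral k i)
  numeral-Digits zero    = []
  numeral-Digits (suc i) = increment-Digits (numeral-Digits i)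

  digit≤k : ∀ {xs} → Digits k xs → ∀ e → digit k xs e ≤ k
  digit≤k []         _       = z≤n
  digit≤k (x∈ ∷ _)   zero    = proj₂ x∈
  digit≤k (_ ∷ xs∈)  (suc e) = digit≤k xs∈ e

  digit-kRun : ∀ xs e → e < kRun k xs → digit k xs e ≡ k
  digit-kRun (x ∷ xs) e e<run with x ≟ k
  digit-kRun (x ∷ xs) zero    _           | yes x≡k = x≡k
  digit-kRun (x ∷ xs) (suc e) (s≤s e<run) | yes _   = digit-kRun xs e e<run

  stableConfig-stable : ∀ {xs} → Digits k xs → Stable k (stableConfig k xs)
  stableConfig-stable _   []      = ≤-refl
  stableConfig-stable xs∈ (_ ∷ v) = s≤s (digit≤k xs∈ (length v))

  odometer-stabilizing : ∀ i → Stabilizing (initial k (suc i * k)) (odometer k i)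
  odometer-stabilizing i = ─→-stabilizing (odometer-─→ k i) (stableConfig-stable (numeral-Digits i))

  odometer-minimal : ∀ i {U} → Stabilizing (initial k (suc i * k)) U → odometer k i ≤̇ U
  odometer-minimal zero    _    _ = z≤n
  odometer-minimal (suc i) {U} stab v = begin
    odometer k i v + avalanche k xs v ≤⟨ +-monoʳ-≤ _ (Descent.bound c W stabW j ≤-refl full v) ⟩
    odometer k i v + W v              ≡⟨ m+[n∸m]≡n (previous v) ⟩
    U v                               ∎
    where
    open ≤-Reasoning
    xs = numeral k i
    j = suc (kRun k xs)
    c = initial k k ⊕ stableConfig k xs
    W : Odometer k
    W v = U v ∸ odometer k i v
    stab′ : Stabilizing (initial k k ⊕ initial k (suc i * k)) U
    stab′ = stabilizing-≗ (initial-+ k (suc i * k)) stab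
    previous : odometer k i ≤̇ U
    previous = odometer-minimal i (stabilizing-addˡ {a = initial k k} stab′)
    stabW : Stabilizing c W
    stabW = stabilizing-residual (─→-addˡ {a = initial k k} (odometer-─→ k i)) previous stab′
    full : ∀ x v → suc (length v) < j → k ≤ c (x ∷ v)
    full _ v (s≤s |v|<run) = ≤-reflexive (sym (digit-kRun xs (length v) |v|<run))

  runOdometer-unique : ∀ i {c n} (r : Run k (initial k (suc i * k)) c n) → Stable k c →
                       runOdometer r ≗ odometer k i
  runOdometer-unique i r stable v = ≤-antisym (least-action (odometer-stabilizing i) r v)
                                              (odometer-minimal i (─→-stabilizing (run-─→ r) stable) v)

  fires≡ballSum : ∀ i {g} → IsG (suc i) k g → ∃ λ D₀ → ∀ {D} → D₀ ≤ D → g ≡ ballSum D (odometer k i)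
  fires≡ballSum i (_ , r , stable) with run-length r
  ... | D₀ , g≡ = D₀ , λ {D} D₀≤D → trans (g≡ D₀≤D) (ballSum-cong D (runOdometer-unique i r stable))

  fires-increment : ∀ i {g₁ g₀} → IsG (suc (suc i)) k g₁ → IsG (suc i) k g₀ →
                    g₁ ≡ g₀ + avalancheFires k (suc (kRun k (numeral k i)))
  fires-increment i {g₁} {g₀} G₁ G₀ with fires≡ballSum (suc i) G₁ | fires≡ballSum i G₀
  ... | D₁ , g₁≡ | D₀ , g₀≡ = begin
    g₁                                                    ≡⟨ g₁≡ (m⊔n≤o⇒m≤o D₁ D₀ D₁⊔D₀≤D) ⟩
    ballSum D (odometer k i ⊕ avalanche k xs)             ≡⟨ ballSum-⊕ D _ _ ⟩
    ballSum D (odometer k i) + ballSum D (avalanche k xs) ≡⟨ cong₂ _+_ (sym (g₀≡ (m⊔n≤o⇒n≤o D₁ D₀ D₁⊔D₀≤D)))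
                                                                      (ballSum-length k D (j ∸_)) ⟩
    g₀ + levelSum k D (j ∸_)                              ≡⟨ cong (g₀ +_) (levelSum-∸ k j D (m≤n⊔m (D₁ ⊔ D₀) j)) ⟩
    g₀ + avalancheFires k j                               ∎
    where
    open ≡-Reasoning
    xs = numeral k i
    j = suc (kRun k xs)
    D = D₁ ⊔ D₀ ⊔ j
    D₁⊔D₀≤D = m≤m⊔n (D₁ ⊔ D₀) j

  repunit≤value : ∀ {xs} → Digits k xs → repunit k (length xs) ≤ value k xs
  repunit≤value []                = z≤n
  repunit≤value ((1≤x , _) ∷ xs∈) = +-mono-≤ 1≤x (*-monoʳ-≤ k (repunit≤value xs∈))

  value≤k*repunit : ∀ {xs} → Digits k xs → value k xs ≤ k * repunit k (length xs)
  value≤k*repunit []                = ≤-reflexive (sym (*-zeroʳ k))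
  value≤k*repunit ((_ , x≤k) ∷ xs∈) =
    ≤-trans (+-mono-≤ x≤k (*-monoʳ-≤ k (value≤k*repunit xs∈))) (≤-reflexive (sym (*-suc k _)))

  kRun-spec : ∀ {xs} → Digits k xs →
      (value k xs ≡ k * repunit k (length xs) × kRun k xs ≡ length xs)
    ⊎ (value k xs < k * repunit k (length xs) ×
       ∃ λ q → suc (value k xs) ≡ repunit k (length xs) + k ^ kRun k xs * q × ¬ k ∣ q)
  kRun-spec [] = inj₁ (sym (*-zeroʳ k) , refl)
  kRun-spec {x ∷ xs} (x∈ ∷ xs∈) with x ≟ k | kRun-spec xs∈
  ... | yes refl | inj₁ (v≡ , run≡) =
    inj₁ (trans (cong (λ v → k + k * v) v≡) (sym (*-suc k _)) , cong suc run≡)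
  ... | yes refl | inj₂ (v< , q , v≡ , k∤q) =
    inj₂ (subst (k + k * value k xs <_) (sym (*-suc k _)) (+-monoʳ-< k (*-monoʳ-< k v<)) , q , eq , k∤q)
    where
    open ≡-Reasoning
    eq : suc (k + k * value k xs) ≡ suc (k * repunit k (length xs)) + k ^ suc (kRun k xs) * q
    eq = begin
      suc (k + k * value k xs)                              ≡⟨ cong suc (*-suc k (value k xs)) ⟨
      suc (k * suc (value k xs))                            ≡⟨ cong (λ v → suc (k * v)) v≡ ⟩
      suc (k * (repunit k (length xs) + k ^ kRun k xs * q)) ≡⟨ distribute k _ (k ^ kRun k xs) q ⟩
      suc (k * repunit k (length xs)) + k * k ^ kRun k xs * q ∎
      where
      distribute : ∀ m r p q → suc (m * (r + p * q)) ≡ suc (m * r) + m * p * q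
      distribute = solve-∀
  ... | no x≢k | _ = inj₂ (v< , x + k * s , eq , k∤)
    where
    x<k = ≤∧≢⇒< (proj₂ x∈) x≢k
    s = value k xs ∸ repunit k (length xs)
    v< : x + k * value k xs < k * suc (k * repunit k (length xs))
    v< = subst (x + k * value k xs <_) (sym (*-suc k _)) (+-mono-<-≤ x<k (*-monoʳ-≤ k (value≤k*repunit xs∈)))
    eq : suc (x + k * value k xs) ≡ suc (k * repunit k (length xs)) + 1 * (x + k * s)
    eq = trans (cong (λ v → suc (x + k * v)) (sym (m+[n∸m]≡n (repunit≤value xs∈)))) (regroup x k _ s)
      where
      regroup : ∀ x m r s → suc (x + m * (r + s)) ≡ suc (m * r) + 1 * (x + m * s)
      regroup = solve-∀
    k∤ : ¬ k ∣ x + k * s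
    k∤ k∣ = <⇒≱ x<k (∣⇒≤ {{>-nonZero (proj₁ x∈)}} (∣m+n∣m⇒∣n (subst (k ∣_) (+-comm x (k * s)) k∣) (m∣m*n s)))

floorLog-unique : ∀ {k a n n′} .{{_ : NonZero k}} → IsFloorLog k a n → IsFloorLog k a n′ → n ≡ n′
floorLog-unique {k} {a} fl fl′ = ≤-antisym (floorLog-≤ fl fl′) (floorLog-≤ fl′ fl)
  where
  floorLog-≤ : ∀ {n n′} → IsFloorLog k a n → IsFloorLog k a n′ → n ≤ n′
  floorLog-≤ (k^n≤a , _) (_ , a<k^n′+1) = ≮⇒≥ λ n′<n → <⇒≱ a<k^n′+1 (≤-trans (^-monoʳ-≤ k n′<n) k^n≤a)

^-monoʳ-∣ : ∀ k {m n} → m ≤ n → k ^ m ∣ k ^ n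
^-monoʳ-∣ k {m} {n} m≤n =
  divides (k ^ (n ∸ m)) (trans (cong (k ^_) (sym (m∸n+n≡m m≤n))) (^-distribˡ-+-* k (n ∸ m) m))

IsNu-unique : ∀ {k x e e′} → IsNu k x e → IsNu k x e′ → e ≡ e′
IsNu-unique {k} {x} ν ν′ = ≤-antisym (IsNu-≤ ν′ ν) (IsNu-≤ ν ν′)
  where
  IsNu-≤ : ∀ {e e′} → IsNu k x e → IsNu k x e′ → e′ ≤ e
  IsNu-≤ (_ , k^e+1∤x) (k^e′∣x , _) = ≮⇒≥ λ e<e′ → k^e+1∤x (∣-trans (^-monoʳ-∣ k e<e′) k^e′∣x)

IsNu-pow : ∀ {k} .{{_ : NonZero k}} t {q} → ¬ k ∣ q → IsNu k (k ^ t * q) t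
IsNu-pow {k} t {q} k∤q = m∣m*n q , λ k^t*k∣k^t*q →
  k∤q (*-cancelˡ-∣ (k ^ t) {{m^n≢0 k t}} (subst (_∣ k ^ t * q) (*-comm k (k ^ t)) k^t*k∣k^t*q))

module _ (k₁ : ℕ) where

  private
    k : ℕ
    k = suc (suc k₁)

  repunit-pow : ∀ D → (k ∸ 1) * repunit k D + 1 ≡ k ^ D
  repunit-pow zero    = cong (_+ 1) (*-zeroʳ (suc k₁))
  repunit-pow (suc D) = trans (shift k₁ (repunit k D)) (cong (k *_) (repunit-pow D))
    where
    shift : ∀ a r → suc a * (1 + suc (suc a) * r) + 1 ≡ suc (suc a) * (suc a * r + 1)
    shift = solve-∀

  rep≡repunit : ∀ D → rep k D ≡ repunit k D
  rep≡repunit D = trans (cong (_div (k ∸ 1)) k^D-1) (m*n/n≡m (repunit k D) (suc k₁))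
    where
    k^D-1 : k ^ D ∸ 1 ≡ repunit k D * suc k₁
    k^D-1 = begin
      k ^ D ∸ 1                     ≡⟨ cong (_∸ 1) (repunit-pow D) ⟨
      suc k₁ * repunit k D + 1 ∸ 1  ≡⟨ m+n∸n≡m (suc k₁ * repunit k D) 1 ⟩
      suc k₁ * repunit k D          ≡⟨ *-comm (suc k₁) (repunit k D) ⟩
      repunit k D * suc k₁          ∎
      where open ≡-Reasoning

  floorLog-repunit : ∀ {D m} → repunit k D ≤ m → m < repunit k (suc D) → IsFloorLog k ((k ∸ 1) * m + 1) D
  floorLog-repunit {D} {m} r≤m m<r =
      subst (_≤ (k ∸ 1) * m + 1) (repunit-pow D) (+-monoˡ-≤ 1 (*-monoʳ-≤ (k ∸ 1) r≤m))
    , subst ((k ∸ 1) * m + 1 <_) (repunit-pow (suc D)) (+-monoˡ-< 1 (*-monoʳ-< (k ∸ 1) m<r))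

  avalancheFires-pow : ∀ j → (k ∸ 1) * (k ∸ 1) * avalancheFires k j + (k ∸ 1) * j + k ≡ k ^ suc j
  avalancheFires-pow zero    = base k₁
    where
    base : ∀ a → suc a * suc a * 0 + suc a * 0 + suc (suc a) ≡ suc (suc a) * 1
    base = solve-∀
  avalancheFires-pow (suc j) = trans (shift k₁ j (avalancheFires k j)) (cong (k *_) (avalancheFires-pow j))
    where
    shift : ∀ a j t → suc a * suc a * (suc j + suc (suc a) * t) + suc a * suc j + suc (suc a)
                    ≡ suc (suc a) * (suc a * suc a * t + suc a * j + suc (suc a))
    shift = solve-∀

  formula≡avalancheFires : ∀ j → formula k j ≡ avalancheFires k j
  formula≡avalancheFires j = trans (cong (_div (K ^ 2)) numerator) (m*n/n≡m T (K ^ 2))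
    where
    K = k ∸ 1
    T = avalancheFires k j
    numerator : k ^ suc j ∸ K * j ∸ k ≡ T * K ^ 2
    numerator = begin
      k ^ suc j ∸ K * j ∸ k               ≡⟨ cong (λ x → x ∸ K * j ∸ k) (avalancheFires-pow j) ⟨
      K * K * T + K * j + k ∸ K * j ∸ k   ≡⟨ cong (λ x → x ∸ K * j ∸ k) (xy∙z≈xz∙y (K * K * T) (K * j) k) ⟩
      K * K * T + k + K * j ∸ K * j ∸ k   ≡⟨ cong (_∸ k) (m+n∸n≡m (K * K * T + k) (K * j)) ⟩
      K * K * T + k ∸ k                   ≡⟨ m+n∸n≡m (K * K * T) k ⟩
      K * K * T                           ≡⟨ square K T ⟩
      T * K ^ 2                           ∎
      where
      open ≡-Reasoning
      square : ∀ a t → a * a * t ≡ t * (a * (a * 1))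
      square = solve-∀

  isJ-kRun : ∀ i {n j} → IsFloorLog k ((k ∸ 1) * suc i + 1) n → IsJ k (suc i) n j →
             j ≡ suc (kRun k (numeral k i))
  isJ-kRun i {n} {j} floorLog isJ with kRun-spec k (numeral-Digits k i)
  ... | inj₁ (i≡ , run≡) = all-k isJ
    where
    D = length (numeral k i)
    m≡ : suc i ≡ repunit k (suc D)
    m≡ = cong suc (trans (sym (value-numeral k i)) i≡)
    n≡ : n ≡ suc D
    n≡ = floorLog-unique floorLog (floorLog-repunit {suc D} (≤-reflexive (sym m≡))
                                     (subst (_< repunit k (suc (suc D))) (sym m≡) (s≤s (m≤n*m _ k))))
    all-k : IsJ k (suc i) n j → j ≡ suc (kRun k (numeral k i))
    all-k (inj₁ (_ , j≡n))   = trans j≡n (trans n≡ (cong suc (sym run≡)))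
    all-k (inj₂ (m≢rep , _)) = contradiction (trans m≡ (sym (trans (cong (rep k) n≡) (rep≡repunit (suc D)))))
                                             m≢rep
  ... | inj₂ (i< , q , m≡ , k∤q) = carry isJ
    where
    xs = numeral k i
    D = length xs
    r≤i : repunit k D ≤ i
    r≤i = subst (repunit k D ≤_) (value-numeral k i) (repunit≤value k (numeral-Digits k i))
    n≡ : n ≡ D
    n≡ = floorLog-unique floorLog (floorLog-repunit {D} (≤-trans r≤i (n≤1+n i))
                                     (s≤s (subst (_< k * repunit k D) (value-numeral k i) i<)))
    rep≡ : rep k n ≡ repunit k D
    rep≡ = trans (cong (rep k) n≡) (rep≡repunit D)
    excess : suc i ∸ rep k n ≡ k ^ kRun k xs * q
    excess = begin
      suc i ∸ rep k n                               ≡⟨ cong₂ _∸_ (cong suc (sym (value-numeral k i))) rep≡ ⟩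
      suc (value k xs) ∸ repunit k D                ≡⟨ cong (_∸ repunit k D) m≡ ⟩
      repunit k D + k ^ kRun k xs * q ∸ repunit k D ≡⟨ m+n∸m≡n (repunit k D) _ ⟩
      k ^ kRun k xs * q                             ∎
      where open ≡-Reasoning
    carry : IsJ k (suc i) n j → j ≡ suc (kRun k xs)
    carry (inj₁ (m≡rep , _))   = contradiction (subst (_≤ i) (sym (trans m≡rep rep≡)) r≤i) 1+n≰n
    carry (inj₂ (_ , e , ν , j≡)) = trans j≡ (cong suc (IsNu-unique ν ν′))
      where
      ν′ : IsNu k (suc i ∸ rep k n) (kRun k xs)
      ν′ = subst (λ x → IsNu k x (kRun k xs)) (sym excess) (IsNu-pow (kRun k xs) k∤q)

mainTheorem18 : (k : ℕ) → 2 ≤ k → (m : ℕ) → 1 ≤ m →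
    (n : ℕ) → IsFloorLog k ((k ∸ 1) * m + 1) n →
    (j : ℕ) → IsJ k m n j →
    (g₁ g₀ : ℕ) → IsG (suc m) k g₁ → IsG m k g₀ →
    g₁ ≡ g₀ + formula k j
mainTheorem18 k@(suc (suc k₁)) (s≤s (s≤s z≤n)) (suc i) (s≤s z≤n) n floorLog j isJ g₁ g₀ G₁ G₀ = begin
  g₁                          ≡⟨ fires-increment k i G₁ G₀ ⟩
  g₀ + avalancheFires k j′    ≡⟨ cong (g₀ +_) (formula≡avalancheFires k₁ j′) ⟨
  g₀ + formula k j′           ≡⟨ cong (λ j → g₀ + formula k j) (isJ-kRun k₁ i floorLog isJ) ⟨
  g₀ + formula k j            ∎
  where
  open ≡-Reasoning
  j′ = suc (kRun k (numeral k i))
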